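{- Let $S\subseteq[n-1]$. Then $$|\{\pi\in\mathcal S_n(321):\mathrm{Des}(\pi)\supseteq S\}|=\begin{cases} C_{n-|S|} & \mbox{if $S$ contains no two consecutive elements,} \\ 0 &\mbox{otherwise.}\end{cases}$$
   Context: $\mathcal S_n(321)$ is the set of $321$-avoiding permutations of $\{1,\dots,n\}$; $\mathrm{Des}(\pi)=\{i:\pi(i)>\pi(i+1)\}$; $C_m=\frac{1}{m+1}\binom{2m}{m}$ is the $m$-th Catalan number. -}

module Defs where

open import Data.Nat using (ℕ; zero; suc; _<_; _>_; _∸_; _+_; _/_)
open import Data.Nat.Combinatorics using (_C_)
open import Data.Fin using (Fin; toℕ)
open import Data.Fin.Subset using (Subset; _∈_; ∣_∣)
open import Data.Vec using (Vec; []; _∷_; toList)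
open import Data.List using (List)
open import Data.List.Relation.Unary.Unique.Propositional using (Unique)
open import Data.Product using (Σ; _×_; ∃)
open import Data.Empty using (⊥)
open import Relation.Nullary using (¬_)

catalan : ℕ → ℕ
catalan m = ((m + m) C m) / suc m

-- one-line notation: a permutation of [n] (0-based values Fin n) is a
-- vector of length n whose entries are pairwise distinct
IsPerm : {n : ℕ} → Vec (Fin n) n → Set
IsPerm v = Unique (toList v)

val : {n : ℕ} → Vec (Fin n) n → Fin n → ℕ
val v i = toℕ (Data.Vec.lookup v i)

Avoids321 : {n : ℕ} → Vec (Fin n) n → Set
Avoids321 {n} v = (i j k : Fin n) → toℕ i < toℕ j → toℕ j < toℕ k →
  ¬ (val v i > val v j × val v j > val v k)

-- descent at (0-based) positions i, i+1.  S ⊆ [n-1] is encoded as a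
-- subset of Fin (n ∸ 1): element i (0-based) stands for descent position i+1.
-- Descent at 1-based position p = toℕ i + 1 means π(p) > π(p+1).
HasDescentAt : {n : ℕ} → Vec (Fin n) n → ℕ → Set
HasDescentAt {n} v p =
  Σ (Fin n) λ a → Σ (Fin n) λ b → toℕ a ≡ p × toℕ b ≡ suc p × val v a > val v b
  where open import Relation.Binary.PropositionalEquality using (_≡_)

DesContains : {n : ℕ} → Vec (Fin n) n → Subset (n ∸ 1) → Set
DesContains {n} v S = (i : Fin (n ∸ 1)) → i ∈ S → HasDescentAt v (toℕ i)

HasConsecutive : {m : ℕ} → Subset m → Set
HasConsecutive {m} S = Σ (Fin m) λ i → Σ (Fin m) λ j →
  toℕ j ≡ suc (toℕ i) × i ∈ S × j ∈ S
  where open import Relation.Binary.PropositionalEquality using (_≡_)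

module Submission where

-- Descents at two adjacent positions i, i+1 form a 321 pattern, which gives
-- the second case (DescentSets).  For the count we enumerate the
-- permutations explicitly.  A 321-avoiding word is a merge of its
-- left-to-right maxima with an increasing sequence of its other entries, so
-- it can be produced left to right from a state (B, A, T): T the current
-- maximum, B the unused values below T (which must appear in increasing
-- order), A the unused values above T.  Each step either emits the least
-- element of B or picks a new maximum from A; descent requirements only
-- restrict which step is allowed.
--
-- Counting shows that the number of
-- outputs is a count of lattice paths in which each required descent
-- removes one up-step, and Catalan evaluates that count by the reflection
-- principle.

open import Defs
open import Data.Nat
open import Data.Nat.Properties
open import Data.Nat.Combinatorics using (_C_; nCk+nC[k+1]≡[n+1]C[k+1]; nCk≡nC[n∸k])
open import Data.Nat.DivMod using (m*n/n≡m; _mod_; m<n⇒m%n≡m)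
open import Data.Nat.Tactic.RingSolver using (solve-∀)
open import Data.Bool using (Bool; true; false; if_then_else_)
open import Data.Fin using (Fin; zero; suc; toℕ)
open import Data.Fin.Properties using (toℕ-injective; toℕ<n; toℕ-fromℕ<)
open import Data.Fin.Subset using (Subset; ∣_∣) renaming (_∈_ to _∈ₛ_)
open import Data.Vec using (Vec; []; _∷_; lookup; toList; here; there)
open import Data.Vec.Properties using (length-toList)
open import Data.List using (List; []; _∷_; [_]; _++_; map; length; upTo)
import Data.List.Properties as List
open import Data.List.Relation.Unary.All as All using (All; []; _∷_)
import Data.List.Relation.Unary.All.Properties as All
open import Data.List.Relation.Unary.AllPairs using (AllPairs; []; _∷_)
import Data.List.Relation.Unary.AllPairs.Properties as AllPairs
open import Data.List.Relation.Unary.Any using (here; there)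
open import Data.List.Membership.Propositional using (_∈_)
open import Data.List.Membership.Propositional.Properties using (∈-++⁺ˡ; ∈-++⁺ʳ; ∈-++⁻; ∈-∃++; ∈-map⁺; ∈-map⁻; ∈-upTo⁺; ∈-upTo⁻)
open import Data.List.Relation.Binary.Permutation.Propositional using (_↭_; prep; ↭-sym; ↭-trans; ↭-reflexive; ↭-refl; ↭⇒↭ₛ)
open import Data.List.Relation.Binary.Permutation.Propositional.Properties using (All-resp-↭; ∈-resp-↭; ↭-empty-inv; ↭-length; drop-∷; drop-mid; shift)
open import Data.List.Relation.Binary.Disjoint.Propositional using (Disjoint)
open import Data.List.Relation.Unary.Unique.Propositional using (Unique)
import Data.List.Relation.Unary.Unique.Propositional.Properties as Unique
open import Data.Product using (Σ; ∃₂; _×_; _,_; proj₂)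
open import Data.Sum using (inj₁; inj₂)
open import Data.Unit using (⊤; tt)
open import Data.Empty using (⊥; ⊥-elim)
open import Function using (_∘_; id)
open import Function.Bundles using (_⇔_; mk⇔; Equivalence)
open import Relation.Nullary using (¬_)
open import Relation.Binary.PropositionalEquality using (_≡_; refl; sym; trans; cong; cong₂; subst; subst₂; setoid; module ≡-Reasoning)
open import Data.List.Relation.Binary.Permutation.Setoid.Properties (setoid ℕ) using (Unique-resp-↭)

module Lists where

  unique⊆⇒↭ : ∀ {A : Set} {xs ys : List A} → Unique xs → (∀ {y} → y ∈ xs → y ∈ ys) →
              length ys ≤ length xs → xs ↭ ys
  unique⊆⇒↭ {xs = []}     {[]}    _ _ _  = ↭-refl
  unique⊆⇒↭ {xs = []}     {_ ∷ _} _ _ ()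
  unique⊆⇒↭ {xs = x ∷ xs} (x∉ ∷ u) sub len with us , ws , refl ← ∈-∃++ (sub (here refl)) =
    ↭-trans (prep x (unique⊆⇒↭ u sub′ len′)) (↭-sym (shift x us ws))
    where
    sub′ : ∀ {y} → y ∈ xs → y ∈ us ++ ws
    sub′ y∈ with ∈-++⁻ us (sub (there y∈))
    ... | inj₁ p          = ∈-++⁺ˡ p
    ... | inj₂ (here y≡x) = ⊥-elim (All.lookup x∉ y∈ (sym y≡x))
    ... | inj₂ (there p)  = ∈-++⁺ʳ us p
    len′ : length (us ++ ws) ≤ length xs
    len′ = ≤-pred (≤-trans (≤-reflexive (sym (List.length-++-sucʳ us x ws))) len)

  length-empty : ∀ {A : Set} (L : List A) → (∀ x → ¬ x ∈ L) → length L ≡ 0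
  length-empty []      _    = refl
  length-empty (x ∷ L) none = ⊥-elim (none x (here refl))

open Lists

module Catalan where

  open ≡-Reasoning

  -- Binomial coefficients by Pascal's rule; unlike _C_ this computes by
  -- pattern matching, which is what the inductions below need.
  binom : ℕ → ℕ → ℕ
  binom n       zero    = 1
  binom zero    (suc k) = 0
  binom (suc n) (suc k) = binom n k + binom n (suc k)

  binom≡C : ∀ n k → binom n k ≡ n C k
  binom≡C n       zero    = refl
  binom≡C zero    (suc k) = refl
  binom≡C (suc n) (suc k) =
    trans (cong₂ _+_ (binom≡C n k) (binom≡C n (suc k))) (nCk+nC[k+1]≡[n+1]C[k+1] n k)

  binom-1 : ∀ n → binom n 1 ≡ n
  binom-1 zero    = refl
  binom-1 (suc n) = cong suc (binom-1 n)

  absorption : ∀ n k → suc k * binom n (suc k) + k * binom n k ≡ n * binom n k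
  absorption zero    zero    = refl
  absorption zero    (suc k) = cong₂ _+_ (*-zeroʳ (suc (suc k))) (*-zeroʳ (suc k))
  absorption (suc n) zero    =
    trans (cong (λ x → 1 * x + 0 * 1) (binom-1 (suc n))) (unit (suc n))
    where
    unit : ∀ m → 1 * m + 0 * 1 ≡ m * 1
    unit = solve-∀
  absorption (suc n) (suc k) = begin
    suc (suc k) * (b + c) + suc k * (a + b)
      ≡⟨ regroup k a b c ⟩
    (suc (suc k) * c + suc k * b) + (suc k * b + k * a) + (a + b)
      ≡⟨ cong₂ (λ u w → u + w + (a + b)) (absorption n (suc k)) (absorption n k) ⟩
    n * b + n * a + (a + b)
      ≡⟨ collect n a b ⟩
    suc n * (a + b) ∎
    where
    a b c : ℕ
    a = binom n k
    b = binom n (suc k)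
    c = binom n (suc (suc k))
    regroup : ∀ k a b c → suc (suc k) * (b + c) + suc k * (a + b)
                        ≡ (suc (suc k) * c + suc k * b) + (suc k * b + k * a) + (a + b)
    regroup = solve-∀
    collect : ∀ n a b → n * b + n * a + (a + b) ≡ suc n * (a + b)
    collect = solve-∀

  binom-middle : ∀ a → binom (suc (a + a)) (suc a) ≡ binom (suc (a + a)) a
  binom-middle a = begin
    binom M (suc a)      ≡⟨ binom≡C M (suc a) ⟩
    M C suc a            ≡⟨ nCk≡nC[n∸k] (s≤s (m≤m+n a a)) ⟩
    M C (M ∸ suc a)      ≡⟨ cong (M C_) (m+n∸m≡n a a) ⟩
    M C a                ≡⟨ binom≡C M a ⟨
    binom M a            ∎
    where
    M : ℕ
    M = suc (a + a)

  binomBelow : ℕ → ℕ → ℕ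
  binomBelow N zero    = 0
  binomBelow N (suc a) = binom N a

  pascal : ∀ N a → binom (suc N) a ≡ binomBelow N a + binom N a
  pascal N zero    = refl
  pascal N (suc a) = refl

  -- dyck h u counts the lattice paths that start at height h, use u up-steps
  -- and h + u down-steps, and never go below 0; dyck 0 m counts Dyck paths.
  dyck : ℕ → ℕ → ℕ
  dyck zero    zero    = 1
  dyck (suc h) zero    = dyck h zero
  dyck zero    (suc u) = dyck 1 u
  dyck (suc h) (suc u) = dyck h (suc u) + dyck (suc (suc h)) u

  dyck-flat : ∀ h → dyck h 0 ≡ 1
  dyck-flat zero    = refl
  dyck-flat (suc h) = dyck-flat h

  -- Reflection principle (ballot numbers): with N = h + 2u,
  -- dyck h u = C(N,u) - C(N,u-1), stated additively.
  reflection : ∀ {N} h u → h + u + u ≡ N → dyck h u + binomBelow N u ≡ binom N u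
  reflection h zero refl = cong (_+ 0) (dyck-flat h)
  reflection zero (suc u) eq =
    subst (λ K → dyck 1 u + binom K u ≡ binom K (suc u))
          (trans (cong suc (sym (+-suc u u))) eq) row
    where
    M : ℕ
    M = suc (u + u)
    row : dyck 1 u + binom (suc M) u ≡ binom (suc M) (suc u)
    row = begin
      dyck 1 u + binom (suc M) u          ≡⟨ cong (dyck 1 u +_) (pascal M u) ⟩
      dyck 1 u + (binomBelow M u + binom M u)
                                          ≡⟨ +-assoc (dyck 1 u) _ _ ⟨
      (dyck 1 u + binomBelow M u) + binom M u
                                          ≡⟨ cong (_+ binom M u) (reflection 1 u refl) ⟩
      binom M u + binom M u               ≡⟨ cong (binom M u +_) (binom-middle u) ⟨
      binom M u + binom M (suc u)         ∎
  reflection (suc h) (suc u) refl = begin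
    (dyck h (suc u) + dyck (suc (suc h)) u) + binom (suc N) u
      ≡⟨ cong (dyck h (suc u) + dyck (suc (suc h)) u +_) (pascal N u) ⟩
    (dyck h (suc u) + dyck (suc (suc h)) u) + (binomBelow N u + binom N u)
      ≡⟨ interchange (dyck h (suc u)) _ _ _ ⟩
    (dyck (suc (suc h)) u + binomBelow N u) + (dyck h (suc u) + binom N u)
      ≡⟨ cong₂ _+_ (reflection (suc (suc h)) u (rebalance h u)) (reflection h (suc u) refl) ⟩
    binom N u + binom N (suc u) ∎
    where
    N : ℕ
    N = h + suc u + suc u
    interchange : ∀ p q r s → (p + q) + (r + s) ≡ (q + r) + (p + s)
    interchange = solve-∀
    rebalance : ∀ h u → suc (suc h) + u + u ≡ h + suc u + suc u
    rebalance = solve-∀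

  -- (m+1)·dyck 0 m = C(2m,m): reflection gives dyck 0 m = C(2m,m) - C(2m,m-1),
  -- and absorption gives m·C(2m,m) = (m+1)·C(2m,m-1).
  dyck-times : ∀ m → dyck 0 m * suc m ≡ binom (m + m) m
  dyck-times zero = refl
  dyck-times m@(suc k) = +-cancelˡ-≡ (m * top) _ _ (begin
    m * top + dyck 0 m * suc m         ≡⟨ cong (_+ dyck 0 m * suc m) lower ⟩
    suc m * below + dyck 0 m * suc m   ≡⟨ factor m (dyck 0 m) below ⟩
    suc m * (dyck 0 m + below)         ≡⟨ cong (suc m *_) (reflection 0 m refl) ⟩
    suc m * top                        ≡⟨ unfold m top ⟩
    m * top + top                      ∎)
    where
    top below : ℕ
    top = binom (m + m) m
    below = binom (m + m) k
    lower : m * top ≡ suc m * below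
    lower = +-cancelʳ-≡ (k * below) _ _ (trans (absorption (m + m) k) (double k below))
      where
      double : ∀ k b → (suc k + suc k) * b ≡ suc (suc k) * b + k * b
      double = solve-∀
    factor : ∀ m p b → suc m * b + p * suc m ≡ suc m * (p + b)
    factor = solve-∀
    unfold : ∀ m t → suc m * t ≡ m * t + t
    unfold = solve-∀

  catalan≡dyck : ∀ m → catalan m ≡ dyck 0 m
  catalan≡dyck m = begin
    ((m + m) C m) / suc m       ≡⟨ cong (_/ suc m) (binom≡C (m + m) m) ⟨
    binom (m + m) m / suc m     ≡⟨ cong (_/ suc m) (dyck-times m) ⟨
    dyck 0 m * suc m / suc m    ≡⟨ m*n/n≡m (dyck 0 m) (suc m) ⟩
    dyck 0 m                    ∎

open Catalan

-- A list of requirements bs asks for a descent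
-- at gap i (between entries i and i+1) whenever its i-th bit is true; such
-- lists are read as padded with false on the right.
module Words where

  hd : List Bool → Bool
  hd []      = false
  hd (b ∷ _) = b

  tl : List Bool → List Bool
  tl []       = []
  tl (_ ∷ bs) = bs

  trues : List Bool → ℕ
  trues []           = 0
  trues (true  ∷ bs) = suc (trues bs)
  trues (false ∷ bs) = trues bs

  NoAdjacent : List Bool → Set
  NoAdjacent []           = ⊤
  NoAdjacent (false ∷ bs) = NoAdjacent bs
  NoAdjacent (true  ∷ bs) = hd bs ≡ false × NoAdjacent bs

  -- Free21Below t xs: no entry y of xs with y < t is followed by a smaller entry,
  -- i.e. t cannot start a 321 pattern with two entries of xs.
  Free21Below : ℕ → List ℕ → Set
  Free21Below t []       = ⊤
  Free21Below t (y ∷ ys) = (y < t → All (y ≤_) ys) × Free21Below t ys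

  Free321 : List ℕ → Set
  Free321 []       = ⊤
  Free321 (x ∷ xs) = Free21Below x xs × Free321 xs

  StepsDown : ℕ → List ℕ → Set
  StepsDown x []      = ⊥
  StepsDown x (y ∷ _) = y < x

  Descends : List Bool → List ℕ → Set
  Descends []       _        = ⊤
  Descends (b ∷ bs) []       = ⊤
  Descends (b ∷ bs) (x ∷ xs) = (b ≡ true → StepsDown x xs) × Descends bs xs

  Free21Below-zero : ∀ xs → Free21Below 0 xs
  Free21Below-zero []       = tt
  Free21Below-zero (x ∷ xs) = (λ ()) , Free21Below-zero xs

  Free21Below-mono : ∀ {t t′} → t ≤ t′ → ∀ ys → Free21Below t′ ys → Free21Below t ys
  Free21Below-mono t≤t′ []       _         = tt
  Free21Below-mono t≤t′ (y ∷ ys) (inc , f) =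
    (λ y<t → inc (<-≤-trans y<t t≤t′)) , Free21Below-mono t≤t′ ys f

  Descends-single : ∀ {cs t} → hd cs ≡ false → Descends cs (t ∷ [])
  Descends-single {[]}               _ = tt
  Descends-single {false ∷ []}       _ = (λ ()) , tt
  Descends-single {false ∷ (_ ∷ _)}  _ = (λ ()) , tt

  Descends-retarget : ∀ {cs t t′ xs} → hd cs ≡ false →
                      Descends cs (t ∷ xs) → Descends cs (t′ ∷ xs)
  Descends-retarget {[]}         _ _       = tt
  Descends-retarget {false ∷ cs} _ (_ , d) = (λ ()) , d

  Descends-head : ∀ {cs t xs} → ¬ StepsDown t xs → Descends cs (t ∷ xs) → hd cs ≡ false
  Descends-head {[]}         _  _       = refl
  Descends-head {false ∷ cs} _  _       = refl
  Descends-head {true  ∷ cs} ¬s (d , _) = ⊥-elim (¬s (d refl))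

  below-all⇒¬StepsDown : ∀ {t ys} → All (t <_) ys → ¬ StepsDown t ys
  below-all⇒¬StepsDown (t<y ∷ _) y<t = <-asym t<y y<t

open Words

module Generator where

  unless : {X : Set} → Bool → List X → List X
  unless true  _ = []
  unless false L = L

  ∈-unless⁺ : ∀ {X : Set} {c} {L : List X} {x} → c ≡ false → x ∈ L → x ∈ unless c L
  ∈-unless⁺ refl p = p

  ∈-unless⁻ : ∀ {X : Set} c {L : List X} {x} → x ∈ unless c L → c ≡ false × x ∈ L
  ∈-unless⁻ false p = refl , p

  Unique-unless : ∀ {X : Set} c {L : List X} → Unique L → Unique (unless c L)
  Unique-unless true  _ = []
  Unique-unless false u = u

  length-unless : ∀ {X : Set} c {L : List X} {n} → length L ≡ n →
                  length (unless c L) ≡ (if c then 0 else n)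
  length-unless true  _  = refl
  length-unless false eq = eq

  -- The generator.  gen cs B A lists the continuations xs of a partial word
  -- with current maximum T, where B holds the unused values below T (they
  -- must appear in increasing order) and A those above T; cs gives the
  -- descent requirements at the gaps of T ∷ xs.  Either the least value of B
  -- comes next (unless a descent is required right after it), or (unless a
  -- descent is required before it) jump picks a new maximum from A and moves
  -- the values of A it passes over into B.
  mutual
    gen : List Bool → List ℕ → List ℕ → List (List ℕ)
    gen cs []      []      = unless (hd cs) [ [] ]
    gen cs []      (a ∷ A) = unless (hd cs) (jump (tl cs) [] (a ∷ A))
    gen cs (b ∷ B) A       = unless (hd (tl cs)) (map (b ∷_) (gen (tl cs) B A))
                          ++ unless (hd cs) (jump (tl cs) (b ∷ B) A)

    jump : List Bool → List ℕ → List ℕ → List (List ℕ)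
    jump bs B []      = []
    jump bs B (a ∷ A) = map (a ∷_) (gen bs B A) ++ jump bs (B ++ [ a ]) A

  jump-head : ∀ bs B A {xs} → xs ∈ jump bs B A → ∃₂ λ x ys → xs ≡ x ∷ ys × x ∈ A
  jump-head bs B (a ∷ A) p with ∈-++⁻ (map (a ∷_) (gen bs B A)) p
  ... | inj₁ q with _ , _ , refl ← ∈-map⁻ (a ∷_) q = a , _ , refl , here refl
  ... | inj₂ q with x , ys , refl , x∈A ← jump-head bs (B ++ [ a ]) A q =
    x , ys , refl , there x∈A

  Ascending : List ℕ → Set
  Ascending = AllPairs _<_

  record Split (B A : List ℕ) (T : ℕ) : Set where
    constructor split
    field
      low-asc  : Ascending B
      high-asc : Ascending A
      low<T    : All (_< T) B
      T≤high   : All (T ≤_) A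

  split-down : ∀ {b B A T} → Split (b ∷ B) A T → Split B A T
  split-down (split (_ ∷ asc) high b<T T≤) = split asc high (All.tail b<T) T≤

  split-emit : ∀ {B a A T} → Split B (a ∷ A) T → Split B A a
  split-emit (split low (a< ∷ asc) B<T (T≤a ∷ _)) =
    split low asc (All.map (λ b<T → <-≤-trans b<T T≤a) B<T) (All.map <⇒≤ a<)

  split-push : ∀ {B a A T} → Split B (a ∷ A) T → Split (B ++ [ a ]) A (suc a)
  split-push (split low (a< ∷ asc) B<T (T≤a ∷ _)) =
    split (AllPairs.++⁺ low ([] ∷ []) (All.map (λ b<T → <-≤-trans b<T T≤a ∷ []) B<T))
          asc
          (All.++⁺ (All.map (λ b<T → m<n⇒m<1+n (<-≤-trans b<T T≤a)) B<T) (n<1+n _ ∷ []))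
          a<

  record Valid (cs : List Bool) (B A : List ℕ) (T : ℕ) (xs : List ℕ) : Set where
    constructor valid
    field
      perm : xs ↭ B ++ A
      free : Free321 (T ∷ xs)
      desc : Descends cs (T ∷ xs)

  least-low : ∀ {b B A T} → Split (b ∷ B) A T → All (b <_) (B ++ A)
  least-low (split (b< ∷ _) _ (b<T ∷ _) T≤) = All.++⁺ b< (All.map (<-≤-trans b<T) T≤)

  low∉high : ∀ {b B A T} → Split (b ∷ B) A T → ¬ b ∈ A
  low∉high (split _ _ (b<T ∷ _) T≤) b∈A = <⇒≱ b<T (All.lookup T≤ b∈A)

  -- For each move of the generator, validity before and after the move agree
  -- (⁺: the move extends a valid continuation, ⁻: every valid continuation
  -- starting with this move arises so).

  -- Emitting the least low value b: possible exactly when no descent is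
  -- required right after b (the next entry is always larger than b).
  valid-down⁺ : ∀ {cs b B A T ys} → Split (b ∷ B) A T → hd (tl cs) ≡ false →
                Valid (tl cs) B A T ys → Valid cs (b ∷ B) A T (b ∷ ys)
  valid-down⁺ {cs} {b} {T = T} {ys} s@(split _ _ (b<T ∷ _) _) no-desc (valid p (below , free) d) =
    valid (prep b p)
          (((λ _ → All.map <⇒≤ b<ys) , below) , Free21Below-mono (<⇒≤ b<T) _ below , free)
          (desc cs no-desc d)
    where
    b<ys : All (b <_) ys
    b<ys = All-resp-↭ (↭-sym p) (least-low s)
    desc : ∀ cs → hd (tl cs) ≡ false → Descends (tl cs) (T ∷ ys) → Descends cs (T ∷ b ∷ ys)
    desc []       _  _ = tt
    desc (c ∷ cs) nd d = (λ _ → b<T) , Descends-retarget nd d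

  valid-down⁻ : ∀ {cs b B A T ys} → Split (b ∷ B) A T → Valid cs (b ∷ B) A T (b ∷ ys) →
                hd (tl cs) ≡ false × Valid (tl cs) B A T ys
  valid-down⁻ {cs} {b} {T = T} {ys} s (valid p ((_ , below) , (_ , free)) d) =
    no-desc cs d , valid (drop-∷ p) (below , free) (desc cs d)
    where
    b<ys : All (b <_) ys
    b<ys = All-resp-↭ (↭-sym (drop-∷ p)) (least-low s)
    no-desc : ∀ cs → Descends cs (T ∷ b ∷ ys) → hd (tl cs) ≡ false
    no-desc []       _       = refl
    no-desc (c ∷ cs) (_ , d) = Descends-head (below-all⇒¬StepsDown b<ys) d
    desc : ∀ cs → Descends cs (T ∷ b ∷ ys) → Descends (tl cs) (T ∷ ys)
    desc []       _       = tt
    desc (c ∷ cs) (s , d) = Descends-retarget (no-desc (c ∷ cs) (s , d)) d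

  valid-emit⁺ : ∀ {cs B a A T ys} → Split B (a ∷ A) T → hd cs ≡ false →
                Valid (tl cs) B A a ys → Valid cs B (a ∷ A) T (a ∷ ys)
  valid-emit⁺ {cs} {B} {a} {A} {T} {ys} (split _ _ _ (T≤a ∷ _)) no-desc (valid p (below , free) d) =
    valid (↭-trans (prep a p) (↭-sym (shift a B A)))
          (((λ a<T → ⊥-elim (≤⇒≯ T≤a a<T)) , Free21Below-mono T≤a _ below) , below , free)
          (desc cs no-desc d)
    where
    desc : ∀ cs → hd cs ≡ false → Descends (tl cs) (a ∷ ys) → Descends cs (T ∷ a ∷ ys)
    desc []           _ _ = tt
    desc (false ∷ cs) _ d = (λ ()) , d

  valid-emit⁻ : ∀ {cs B a A T ys} → Split B (a ∷ A) T → Valid cs B (a ∷ A) T (a ∷ ys) →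
                hd cs ≡ false × Valid (tl cs) B A a ys
  valid-emit⁻ {cs} {B} {a} {A} {T} {ys} (split _ _ _ (T≤a ∷ _)) (valid p (_ , free) d) =
    Descends-head (≤⇒≯ T≤a) d , valid (drop-mid [] B p) free (desc cs d)
    where
    desc : ∀ cs → Descends cs (T ∷ a ∷ ys) → Descends (tl cs) (a ∷ ys)
    desc []       _       = tt
    desc (c ∷ cs) (_ , d) = d

  -- Skipping the value a of A (it joins B) when the next entry x is a larger
  -- element of A; the threshold moves to a + 1.
  valid-push⁺ : ∀ {cs B a A T x ys} → Split B (a ∷ A) T → x ∈ A → hd cs ≡ false →
                Valid cs (B ++ [ a ]) A (suc a) (x ∷ ys) → Valid cs B (a ∷ A) T (x ∷ ys)
  valid-push⁺ {B = B} {a} {A} {T} {x} (split _ (a< ∷ _) _ (T≤a ∷ _)) x∈A no-desc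
              (valid p ((_ , below) , free) d) =
    valid (↭-trans p (↭-reflexive (List.++-assoc B [ a ] A)))
          (((λ x<T → ⊥-elim (≤⇒≯ T≤x x<T)) , Free21Below-mono (m≤n⇒m≤1+n T≤a) _ below) , free)
          (Descends-retarget no-desc d)
    where
    T≤x : T ≤ x
    T≤x = ≤-trans T≤a (<⇒≤ (All.lookup a< x∈A))

  valid-push⁻ : ∀ {cs B a A T x ys} → Split B (a ∷ A) T → x ∈ A →
                Valid cs B (a ∷ A) T (x ∷ ys) → Valid cs (B ++ [ a ]) A (suc a) (x ∷ ys)
  valid-push⁻ {B = B} {a} {A} {x = x} (split _ (a< ∷ _) _ (T≤a ∷ _)) x∈A
              (valid p (_ , below , free) d) =
    valid (↭-trans p (↭-reflexive (sym (List.++-assoc B [ a ] A))))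
          (((λ x≤a → ⊥-elim (<⇒≱ a<x (≤-pred x≤a))) , Free21Below-mono a<x _ below) , below , free)
          (Descends-retarget (Descends-head (≤⇒≯ (≤-trans T≤a (<⇒≤ a<x))) d) d)
    where
    a<x : a < x
    a<x = All.lookup a< x∈A

  mutual
    gen-sound : ∀ cs B A {T} → Split B A T → ∀ {xs} → xs ∈ gen cs B A → Valid cs B A T xs
    gen-sound cs [] [] s p with nd , here refl ← ∈-unless⁻ (hd cs) p =
      valid ↭-refl (tt , tt) (Descends-single nd)
    gen-sound cs [] (a ∷ A) s p with nd , q ← ∈-unless⁻ (hd cs) p =
      jump-sound cs [] (a ∷ A) s nd q
    gen-sound cs (b ∷ B) A s p with ∈-++⁻ (unless (hd (tl cs)) (map (b ∷_) (gen (tl cs) B A))) p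
    ... | inj₁ q with nd , r ← ∈-unless⁻ (hd (tl cs)) q
      with _ , ys∈ , refl ← ∈-map⁻ (b ∷_) r =
      valid-down⁺ s nd (gen-sound (tl cs) B A (split-down s) ys∈)
    gen-sound cs (b ∷ B) A s p | inj₂ q with nd , r ← ∈-unless⁻ (hd cs) q =
      jump-sound cs (b ∷ B) A s nd r

    jump-sound : ∀ cs B A {T} → Split B A T → hd cs ≡ false →
                 ∀ {xs} → xs ∈ jump (tl cs) B A → Valid cs B A T xs
    jump-sound cs B (a ∷ A) s nd p with ∈-++⁻ (map (a ∷_) (gen (tl cs) B A)) p
    ... | inj₁ q with _ , ys∈ , refl ← ∈-map⁻ (a ∷_) q =
      valid-emit⁺ s nd (gen-sound (tl cs) B A (split-emit s) ys∈)
    ... | inj₂ q with _ , _ , refl , x∈A ← jump-head (tl cs) (B ++ [ a ]) A q =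
      valid-push⁺ s x∈A nd (jump-sound cs (B ++ [ a ]) A (split-push s) nd q)

  -- A valid continuation can only start with a low value if it is the least one,
  -- since the least one must come later and the low values appear in order.
  low-first : ∀ {cs b B A T x ys} → Split (b ∷ B) A T → Valid cs (b ∷ B) A T (x ∷ ys) →
              x ∈ b ∷ B → x ≡ b
  low-first _ _ (here x≡b) = x≡b
  low-first {b = b} {x = x} (split (b< ∷ _) _ (_ ∷ B<T) _) (valid p ((inc , _) , _) _) (there x∈B)
    with ∈-resp-↭ (↭-sym p) (here {x = b} refl)
  ... | here b≡x   = ⊥-elim (<-irrefl b≡x (All.lookup b< x∈B))
  ... | there b∈ys = ⊥-elim (<⇒≱ b<x (All.lookup (inc (All.lookup B<T x∈B)) b∈ys))
    where
    b<x : b < x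
    b<x = All.lookup b< x∈B

  jump⊆gen : ∀ cs B A {xs} → hd cs ≡ false → xs ∈ jump (tl cs) B A → xs ∈ gen cs B A
  jump⊆gen cs []      (a ∷ A) nd p = ∈-unless⁺ nd p
  jump⊆gen cs (b ∷ B) A       nd p =
    ∈-++⁺ʳ (unless (hd (tl cs)) (map (b ∷_) (gen (tl cs) B A))) (∈-unless⁺ nd p)

  mutual
    gen-complete : ∀ cs B A {T} → Split B A T → ∀ {xs} → Valid cs B A T xs → xs ∈ gen cs B A
    gen-complete cs [] [] s {[]} v = ∈-unless⁺ (Descends-head (λ ()) (Valid.desc v)) (here refl)
    gen-complete cs [] (a ∷ A) s {[]} v with () ← ↭-empty-inv (↭-sym (Valid.perm v))
    gen-complete cs (b ∷ B) A s {[]} v with () ← ↭-empty-inv (↭-sym (Valid.perm v))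
    gen-complete cs B A s {x ∷ ys} v with ∈-++⁻ B (∈-resp-↭ (Valid.perm v) (here refl))
    gen-complete cs (b ∷ B) A s {x ∷ ys} v | inj₁ x∈B with refl ← low-first s v x∈B
      with nd , v′ ← valid-down⁻ s v =
      ∈-++⁺ˡ (∈-unless⁺ nd (∈-map⁺ (b ∷_) (gen-complete (tl cs) B A (split-down s) v′)))
    gen-complete cs B A s {x ∷ ys} v | inj₂ x∈A =
      jump⊆gen cs B A (Descends-head (≤⇒≯ (All.lookup (Split.T≤high s) x∈A)) (Valid.desc v))
               (jump-complete cs B A s x∈A v)

    jump-complete : ∀ cs B A {T} → Split B A T → ∀ {x ys} → x ∈ A →
                    Valid cs B A T (x ∷ ys) → x ∷ ys ∈ jump (tl cs) B A
    jump-complete cs B (a ∷ A) s (here refl) v =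
      ∈-++⁺ˡ (∈-map⁺ (a ∷_) (gen-complete (tl cs) B A (split-emit s) (proj₂ (valid-emit⁻ s v))))
    jump-complete cs B (a ∷ A) s (there x∈A) v =
      ∈-++⁺ʳ (map (a ∷_) (gen (tl cs) B A))
             (jump-complete cs (B ++ [ a ]) A (split-push s) x∈A (valid-push⁻ s x∈A v))

  mutual
    gen-unique : ∀ cs B A {T} → Split B A T → Unique (gen cs B A)
    gen-unique cs []      []      _ = Unique-unless (hd cs) ([] ∷ [])
    gen-unique cs []      (a ∷ A) s = Unique-unless (hd cs) (jump-unique (tl cs) [] (a ∷ A) s)
    gen-unique cs (b ∷ B) A       s =
      Unique.++⁺ (Unique-unless (hd (tl cs))
                   (Unique.map⁺ List.∷-injectiveʳ (gen-unique (tl cs) B A (split-down s))))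
                 (Unique-unless (hd cs) (jump-unique (tl cs) (b ∷ B) A s))
                 disjoint
      where
      disjoint : Disjoint (unless (hd (tl cs)) (map (b ∷_) (gen (tl cs) B A)))
                          (unless (hd cs) (jump (tl cs) (b ∷ B) A))
      disjoint (p , q) with _ , p′ ← ∈-unless⁻ (hd (tl cs)) p | _ , q′ ← ∈-unless⁻ (hd cs) q
        with _ , _ , refl ← ∈-map⁻ (b ∷_) p′ | _ , _ , e , x∈A ← jump-head (tl cs) (b ∷ B) A q′ =
        low∉high s (subst (_∈ A) (sym (List.∷-injectiveˡ e)) x∈A)

    jump-unique : ∀ bs B A {T} → Split B A T → Unique (jump bs B A)
    jump-unique bs B []      _ = []
    jump-unique bs B (a ∷ A) s@(split _ (a< ∷ _) _ _) =
      Unique.++⁺ (Unique.map⁺ List.∷-injectiveʳ (gen-unique bs B A (split-emit s)))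
                 (jump-unique bs (B ++ [ a ]) A (split-push s))
                 disjoint
      where
      disjoint : Disjoint (map (a ∷_) (gen bs B A)) (jump bs (B ++ [ a ]) A)
      disjoint (p , q) with _ , _ , refl ← ∈-map⁻ (a ∷_) p
                            | _ , _ , e , x∈A ← jump-head bs (B ++ [ a ]) A q =
        <-irrefl (List.∷-injectiveˡ e) (All.lookup a< x∈A)

open Generator

-- Emitting the least low value is a
-- down-step of a lattice path at height |B|; picking the (j+1)-th value of A
-- is j+1 up-steps followed by a down-step.  So without requirements the
-- outputs are the paths counted by dyck |B| |A|, and a required descent,
-- which forces an up-run to be followed by a second down-step, costs exactly
-- one up-step.
module Counting where

  mutual
    count : List Bool → ℕ → ℕ → ℕ
    count cs zero    zero    = if hd cs then 0 else 1
    count cs zero    (suc a) = if hd cs then 0 else countJump (tl cs) zero (suc a)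
    count cs (suc d) a       = (if hd (tl cs) then 0 else count (tl cs) d a)
                             + (if hd cs then 0 else countJump (tl cs) (suc d) a)

    countJump : List Bool → ℕ → ℕ → ℕ
    countJump bs d zero    = 0
    countJump bs d (suc a) = count bs d a + countJump bs (suc d) a

  length-prefixed : ∀ (x : ℕ) (L : List (List ℕ)) {n} →
                    length L ≡ n → length (map (x ∷_) L) ≡ n
  length-prefixed x L eq = trans (List.length-map (x ∷_) L) eq

  length-snoc : ∀ (B : List ℕ) a → length (B ++ [ a ]) ≡ suc (length B)
  length-snoc B a = trans (List.length-++ B) (+-comm (length B) 1)

  mutual
    length-gen : ∀ cs B A → length (gen cs B A) ≡ count cs (length B) (length A)
    length-gen cs []      []      = length-unless (hd cs) refl
    length-gen cs []      (a ∷ A) = length-unless (hd cs) (length-jump (tl cs) [] (a ∷ A))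
    length-gen cs (b ∷ B) A       =
      trans (List.length-++ (unless (hd (tl cs)) (map (b ∷_) (gen (tl cs) B A))))
            (cong₂ _+_ (length-unless (hd (tl cs))
                         (length-prefixed b (gen (tl cs) B A) (length-gen (tl cs) B A)))
                       (length-unless (hd cs) (length-jump (tl cs) (b ∷ B) A)))

    length-jump : ∀ bs B A → length (jump bs B A) ≡ countJump bs (length B) (length A)
    length-jump bs B []      = refl
    length-jump bs B (a ∷ A) =
      trans (List.length-++ (map (a ∷_) (gen bs B A)))
            (cong₂ _+_ (length-prefixed a (gen bs B A) (length-gen bs B A))
                       (trans (length-jump bs (B ++ [ a ]) A)
                              (cong (λ d → countJump bs d (length A)) (length-snoc B a))))

  -- dyck′ h u k = dyck h (u - k), the paths left when k required descents
  -- have each removed an up-step (none when k > u).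
  dyck′ : ℕ → ℕ → ℕ → ℕ
  dyck′ h u       zero    = dyck h u
  dyck′ h zero    (suc k) = 0
  dyck′ h (suc u) (suc k) = dyck′ h u k

  -- The same count when the path is forced to step down first.
  dyck′↓ : ℕ → ℕ → ℕ → ℕ
  dyck′↓ zero    u k = 0
  dyck′↓ (suc h) u k = dyck′ h u k

  dyck′-≤ : ∀ h {u k} → k ≤ u → dyck′ h u k ≡ dyck h (u ∸ k)
  dyck′-≤ h z≤n       = refl
  dyck′-≤ h (s≤s k≤u) = dyck′-≤ h k≤u

  -- First step of a path from positive height: down, or up (using one up-step).
  dyck′-step : ∀ h u k → dyck′ (suc h) u k ≡ dyck′ h u k + dyck′ (suc (suc h)) u (suc k)
  dyck′-step h zero    zero    = sym (+-identityʳ _)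
  dyck′-step h (suc u) zero    = refl
  dyck′-step h zero    (suc k) = refl
  dyck′-step h (suc u) (suc k) = dyck′-step h u k

  -- From height 0 the first step is up.
  dyck′-step₀ : ∀ u k → k < u → dyck′ 0 u k ≡ dyck′ 1 u (suc k)
  dyck′-step₀ (suc u) zero    _         = refl
  dyck′-step₀ (suc u) (suc k) (s≤s k<u) = dyck′-step₀ u k k<u

  trues≤length : ∀ bs → trues bs ≤ length bs
  trues≤length []           = z≤n
  trues≤length (true  ∷ bs) = s≤s (trues≤length bs)
  trues≤length (false ∷ bs) = m≤n⇒m≤1+n (trues≤length bs)

  trues-bound : ∀ bs {m} → length bs ≡ m → trues bs ≤ m
  trues-bound bs refl = trues≤length bs

  length-tl : ∀ bs {m} → length bs ≡ m → length (tl bs) ≡ m ∸ 1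
  length-tl []      eq = cong (_∸ 1) eq
  length-tl (_ ∷ _) eq = cong (_∸ 1) eq

  drop-gap : ∀ d {a m} → m ≡ (d + suc a) ∸ 1 → m ≡ d + a
  drop-gap d {a} eq = trans eq (cong (_∸ 1) (+-suc d a))

  mutual
    count-closed : ∀ cs d a → length (tl cs) ≡ (d + a) ∸ 1 → NoAdjacent cs →
      count cs d a ≡ (if hd cs then dyck′↓ d a (trues (tl cs)) else dyck′ d a (trues (tl cs)))
    count-closed (true ∷ bs)          zero    zero    _   _        = refl
    count-closed (true ∷ bs)          zero    (suc a) _   _        = refl
    count-closed (false ∷ _ ∷ _)      zero    zero    ()  _
    count-closed []                   zero    zero    _   _        = refl
    count-closed (false ∷ [])         zero    zero    _   _        = refl
    count-closed []                   zero    (suc a) len _        = jump-closed [] 0 (suc a) len _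
    count-closed (false ∷ [])         zero    (suc a) len _        = jump-closed [] 0 (suc a) len _
    count-closed (false ∷ true ∷ bs)  zero    (suc a) len nc       = jump-closed (true ∷ bs) 0 (suc a) len nc
    count-closed (false ∷ false ∷ bs) zero    (suc a) len nc       =
      trans (jump-closed (false ∷ bs) 0 (suc a) len nc)
            (sym (dyck′-step₀ (suc a) (trues bs) (s≤s (trues-bound (false ∷ bs) len))))
    count-closed (true ∷ [])          (suc d) a       len _        =
      trans (+-identityʳ _) (count-closed [] d a (length-tl [] len) _)
    count-closed (true ∷ false ∷ bs)  (suc d) a       len (_ , nc) =
      trans (+-identityʳ _) (count-closed (false ∷ bs) d a (length-tl (false ∷ bs) len) nc)
    count-closed []                   (suc d) a       len _        =
      trans (cong₂ _+_ (count-closed [] d a (length-tl [] len) _) (jump-closed [] (suc d) a len _))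
            (sym (dyck′-step d a 0))
    count-closed (false ∷ [])         (suc d) a       len _        =
      trans (cong₂ _+_ (count-closed [] d a (length-tl [] len) _) (jump-closed [] (suc d) a len _))
            (sym (dyck′-step d a 0))
    count-closed (false ∷ true ∷ bs)  (suc d) a       len nc       = jump-closed (true ∷ bs) (suc d) a len nc
    count-closed (false ∷ false ∷ bs) (suc d) a       len nc       =
      trans (cong₂ _+_ (count-closed (false ∷ bs) d a (length-tl (false ∷ bs) len) nc)
                       (jump-closed (false ∷ bs) (suc d) a len nc))
            (sym (dyck′-step d a (trues bs)))

    jump-closed : ∀ bs d a → length bs ≡ (d + a) ∸ 1 → NoAdjacent bs →
      countJump bs d a ≡ (if hd bs then dyck′ d a (trues bs) else dyck′ (suc d) a (suc (trues bs)))
    jump-closed []           d       zero    _   _  = refl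
    jump-closed (false ∷ _)  d       zero    _   _  = refl
    jump-closed (true ∷ _)   d       zero    _   _  = refl
    jump-closed []           d       (suc a) len _  =
      trans (cong₂ _+_ (count-closed [] d a (length-tl [] (drop-gap d len)) _)
                       (jump-closed [] (suc d) a (drop-gap d len) _))
            (sym (dyck′-step d a 0))
    jump-closed (false ∷ bs) d       (suc a) len nc =
      trans (cong₂ _+_ (count-closed (false ∷ bs) d a (length-tl (false ∷ bs) (drop-gap d len)) nc)
                       (jump-closed (false ∷ bs) (suc d) a (drop-gap d len) nc))
            (sym (dyck′-step d a (trues bs)))
    jump-closed (true ∷ bs)  zero    (suc a) len nc =
      trans (cong₂ _+_ (count-closed (true ∷ bs) 0 a (length-tl (true ∷ bs) (drop-gap 0 len)) nc)
                       (jump-closed (true ∷ bs) 1 a (drop-gap 0 len) nc))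
            (sym (dyck′-step₀ a (trues bs) (trues-bound (true ∷ bs) len)))
    jump-closed (true ∷ bs)  (suc d) (suc a) len nc =
      trans (cong₂ _+_ (count-closed (true ∷ bs) (suc d) a
                         (length-tl (true ∷ bs) (drop-gap (suc d) len)) nc)
                       (jump-closed (true ∷ bs) (suc (suc d)) a (drop-gap (suc d) len) nc))
            (sym (dyck′-step d a (trues bs)))

open Counting

module Vectors where

  values : ∀ {N m} → Vec (Fin N) m → List ℕ
  values v = map toℕ (toList v)

  All-values⁺ : ∀ {N m} {P : ℕ → Set} (w : Vec (Fin N) m) →
                (∀ k → P (toℕ (lookup w k))) → All P (values w)
  All-values⁺ []      f = []
  All-values⁺ (x ∷ w) f = f zero ∷ All-values⁺ w (f ∘ suc)

  All-values⁻ : ∀ {N m} {P : ℕ → Set} (w : Vec (Fin N) m) →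
                All P (values w) → ∀ k → P (toℕ (lookup w k))
  All-values⁻ (x ∷ w) (p ∷ _)  zero    = p
  All-values⁻ (x ∷ w) (_ ∷ ps) (suc k) = All-values⁻ w ps k

  values-bounded : ∀ {N m} (v : Vec (Fin N) m) → All (_< N) (values v)
  values-bounded v = All-values⁺ v (λ k → toℕ<n (lookup v k))

  -- Reading a list back as a vector of length n over Fin n; entries are taken
  -- mod n and the list is padded or truncated, which is harmless on the lists
  -- to which it is applied.
  pad : ∀ {N} k → List ℕ → Vec (Fin (suc N)) k
  pad         zero    _        = []
  pad         (suc k) []       = zero ∷ pad k []
  pad {N = N} (suc k) (x ∷ xs) = x mod suc N ∷ pad k xs

  fromValues : (n : ℕ) → List ℕ → Vec (Fin n) n
  fromValues zero    _  = []
  fromValues (suc n) xs = pad (suc n) xs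

  mod-toℕ : ∀ {N} (f : Fin (suc N)) → toℕ f mod suc N ≡ f
  mod-toℕ f = toℕ-injective (trans (toℕ-fromℕ< _) (m<n⇒m%n≡m (toℕ<n f)))

  toℕ-mod : ∀ {N x} → x < suc N → toℕ (x mod suc N) ≡ x
  toℕ-mod x<N = trans (toℕ-fromℕ< _) (m<n⇒m%n≡m x<N)

  pad-values : ∀ {N k} (v : Vec (Fin (suc N)) k) → pad k (values v) ≡ v
  pad-values []      = refl
  pad-values (x ∷ v) = cong₂ _∷_ (mod-toℕ x) (pad-values v)

  fromValues-values : ∀ n (v : Vec (Fin n) n) → fromValues n (values v) ≡ v
  fromValues-values zero    [] = refl
  fromValues-values (suc n) v  = pad-values v

  values-pad : ∀ {N} k xs → length xs ≡ k → All (_< suc N) xs → values (pad {N} k xs) ≡ xs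
  values-pad zero    []       _   _          = refl
  values-pad (suc k) (x ∷ xs) len (x< ∷ xs<) =
    cong₂ _∷_ (toℕ-mod x<) (values-pad k xs (suc-injective len) xs<)

  values-fromValues : ∀ n xs → length xs ≡ n → All (_< n) xs → values (fromValues n xs) ≡ xs
  values-fromValues zero    [] _   _  = refl
  values-fromValues (suc n) xs len xs< = values-pad (suc n) xs len xs<

  -- 321-avoidance for vectors of any length (Avoids321 is the case m = N);
  -- generalising the length is what makes induction on the vector possible.
  Avoids321ᵛ : ∀ {N m} → Vec (Fin N) m → Set
  Avoids321ᵛ {m = m} v = (i j k : Fin m) → toℕ i < toℕ j → toℕ j < toℕ k →
    ¬ (toℕ (lookup v i) > toℕ (lookup v j) × toℕ (lookup v j) > toℕ (lookup v k))

  Free21Belowᵛ : ∀ {N m} → ℕ → Vec (Fin N) m → Set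
  Free21Belowᵛ {m = m} t v = (j k : Fin m) → toℕ j < toℕ k →
    ¬ (t > toℕ (lookup v j) × toℕ (lookup v j) > toℕ (lookup v k))

  free21⁺ : ∀ {N m} t (v : Vec (Fin N) m) → Free21Belowᵛ t v → Free21Below t (values v)
  free21⁺ t []      _ = tt
  free21⁺ t (y ∷ w) h =
    (λ y<t → All-values⁺ w (λ k → ≮⇒≥ (λ lt → h zero (suc k) (s≤s z≤n) (y<t , lt)))) ,
    free21⁺ t w (λ j k j<k → h (suc j) (suc k) (s≤s j<k))

  free21⁻ : ∀ {N m} t (v : Vec (Fin N) m) → Free21Below t (values v) → Free21Belowᵛ t v
  free21⁻ t (y ∷ w) _       zero    zero    ()
  free21⁻ t (y ∷ w) (f , _) zero    (suc k) _           (y<t , lt) =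
    <⇒≱ lt (All-values⁻ w (f y<t) k)
  free21⁻ t (y ∷ w) (_ , r) (suc j) (suc k) (s≤s j<k) = free21⁻ t w r j k j<k

  free321⁺ : ∀ {N m} (v : Vec (Fin N) m) → Avoids321ᵛ v → Free321 (values v)
  free321⁺ []      _ = tt
  free321⁺ (x ∷ v) h =
    free21⁺ (toℕ x) v (λ j k j<k → h zero (suc j) (suc k) (s≤s z≤n) (s≤s j<k)) ,
    free321⁺ v (λ i j k i<j j<k → h (suc i) (suc j) (suc k) (s≤s i<j) (s≤s j<k))

  free321⁻ : ∀ {N m} (v : Vec (Fin N) m) → Free321 (values v) → Avoids321ᵛ v
  free321⁻ (x ∷ v) _       zero    zero    _       ()
  free321⁻ (x ∷ v) _       zero    (suc j) zero    _         ()
  free321⁻ (x ∷ v) (f , _) zero    (suc j) (suc k) _         (s≤s j<k) =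
    free21⁻ (toℕ x) v f j k j<k
  free321⁻ (x ∷ v) _       (suc i) zero    _       ()
  free321⁻ (x ∷ v) _       (suc i) (suc j) zero    _         ()
  free321⁻ (x ∷ v) (_ , r) (suc i) (suc j) (suc k) (s≤s i<j) (s≤s j<k) =
    free321⁻ v r i j k i<j j<k

  HasDescentAtᵛ : ∀ {N m} → Vec (Fin N) m → ℕ → Set
  HasDescentAtᵛ {m = m} v p = Σ (Fin m) λ a → Σ (Fin m) λ b →
    toℕ a ≡ p × toℕ b ≡ suc p × toℕ (lookup v a) > toℕ (lookup v b)

  DesContainsᵛ : ∀ {N m k} → Vec (Fin N) m → Subset k → Set
  DesContainsᵛ {k = k} v S = (i : Fin k) → i ∈ₛ S → HasDescentAtᵛ v (toℕ i)

  descent-at-0 : ∀ {N m} {x y : Fin N} {w : Vec (Fin N) m} →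
                 HasDescentAtᵛ (x ∷ y ∷ w) 0 → toℕ y < toℕ x
  descent-at-0 (zero , suc zero , refl , refl , gt) = gt

  descent-tail⁻ : ∀ {N m} {x : Fin N} {v : Vec (Fin N) m} {p} →
                  HasDescentAtᵛ (x ∷ v) (suc p) → HasDescentAtᵛ v p
  descent-tail⁻ (suc a , suc b , ea , eb , gt) = a , b , suc-injective ea , suc-injective eb , gt

  descent-tail⁺ : ∀ {N m} {x : Fin N} {v : Vec (Fin N) m} {p} →
                  HasDescentAtᵛ v p → HasDescentAtᵛ (x ∷ v) (suc p)
  descent-tail⁺ (a , b , ea , eb , gt) = suc a , suc b , cong suc ea , cong suc eb , gt

  descents⁺ : ∀ {N m} (v : Vec (Fin N) m) (S : Subset (m ∸ 1)) →
              DesContainsᵛ v S → Descends (toList S) (values v)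
  descents⁺ []          []      _ = tt
  descents⁺ (x ∷ [])    []      _ = tt
  descents⁺ (x ∷ y ∷ w) (b ∷ S) h =
    (λ { refl → descent-at-0 (h zero here) }) ,
    descents⁺ (y ∷ w) S (λ i i∈ → descent-tail⁻ (h (suc i) (there i∈)))

  descents⁻ : ∀ {N m} (v : Vec (Fin N) m) (S : Subset (m ∸ 1)) →
              Descends (toList S) (values v) → DesContainsᵛ v S
  descents⁻ (x ∷ y ∷ w) (b ∷ S) (d , _) zero    here       = zero , suc zero , refl , refl , d refl
  descents⁻ (x ∷ y ∷ w) (b ∷ S) (_ , r) (suc i) (there i∈) =
    descent-tail⁺ (descents⁻ (y ∷ w) S r i i∈)

open Vectors

module DescentSets where

  adjacent-descents : ∀ {n} (v : Vec (Fin n) n) {p} →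
                      HasDescentAt v p → HasDescentAt v (suc p) → ¬ Avoids321 v
  adjacent-descents v (a , b , refl , b≡ , a>b) (b′ , c , b′≡ , c≡ , b′>c) avoids =
    avoids a b c (subst (toℕ a <_) (sym b≡) (n<1+n _))
                 (subst₂ _<_ (sym b≡) (sym c≡) (n<1+n _))
                 (a>b , subst (λ z → val v z > val v c) (toℕ-injective (trans b′≡ (sym b≡))) b′>c)

  consecutive⇒321 : ∀ {n} {S : Subset (n ∸ 1)} {v : Vec (Fin n) n} →
                    HasConsecutive S → DesContains v S → ¬ Avoids321 v
  consecutive⇒321 {v = v} (i , j , j≡ , i∈ , j∈) des =
    adjacent-descents v (des i i∈) (subst (HasDescentAt v) j≡ (des j j∈))

  shift-consecutive : ∀ {k b} {S : Subset k} → HasConsecutive S → HasConsecutive (b ∷ S)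
  shift-consecutive (i , j , e , i∈ , j∈) = suc i , suc j , cong suc e , there i∈ , there j∈

  noAdjacent : ∀ {k} (S : Subset k) → ¬ HasConsecutive S → NoAdjacent (toList S)
  noAdjacent []                 _   = tt
  noAdjacent (false ∷ S)        ¬hc = noAdjacent S (¬hc ∘ shift-consecutive)
  noAdjacent (true ∷ [])        _   = refl , tt
  noAdjacent (true ∷ false ∷ S) ¬hc = refl , noAdjacent (false ∷ S) (¬hc ∘ shift-consecutive)
  noAdjacent (true ∷ true ∷ S)  ¬hc = ⊥-elim (¬hc (zero , suc zero , refl , here , there here))

  trues-card : ∀ {k} (S : Subset k) → trues (toList S) ≡ ∣ S ∣
  trues-card []          = refl
  trues-card (true ∷ S)  = cong suc (trues-card S)
  trues-card (false ∷ S) = trues-card S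

open DescentSets

module Enumeration (n : ℕ) (S : Subset (n ∸ 1)) where

  Counted : Vec (Fin n) n → Set
  Counted v = IsPerm v × Avoids321 v × DesContains v S

  -- no requirement between the virtual initial maximum 0 and the first entry
  bits : List Bool
  bits = false ∷ toList S

  start : Split [] (upTo n) 0
  start = split [] (AllPairs.applyUpTo⁺₁ id n (λ i<j _ → i<j)) [] (All.tabulate (λ _ → z≤n))

  Word : List ℕ → Set
  Word = Valid bits [] (upTo n) 0

  words : List (List ℕ)
  words = gen bits [] (upTo n)

  perms : List (Vec (Fin n) n)
  perms = map (fromValues n) words

  -- Valid words are lists of n values below n, so they survive the round trip.
  word-values : ∀ {xs} → Word xs → values (fromValues n xs) ≡ xs
  word-values w = values-fromValues n _
    (trans (↭-length (Valid.perm w)) (List.length-applyUpTo id n))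
    (All-resp-↭ (↭-sym (Valid.perm w)) (All.tabulate ∈-upTo⁻))

  -- A counted permutation is a valid word; its entries exhaust [0, n) by
  -- the pigeonhole principle.
  counted⇒word : ∀ v → Counted v → Word (values v)
  counted⇒word v (injective , avoids , des) =
    valid (unique⊆⇒↭ (Unique.map⁺ toℕ-injective injective)
                     (λ y∈ → ∈-upTo⁺ (All.lookup (values-bounded v) y∈))
                     (≤-reflexive length-eq))
          (Free21Below-zero (values v) , free321⁺ v avoids)
          ((λ ()) , descents⁺ v S des)
    where
    length-eq : length (upTo n) ≡ length (values v)
    length-eq = trans (List.length-applyUpTo id n)
                      (sym (trans (List.length-map toℕ (toList v)) (length-toList v)))

  word⇒counted : ∀ v → Word (values v) → Counted v
  word⇒counted v (valid perm (_ , free) (_ , des)) =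
    Unique.map⁻ (Unique-resp-↭ (↭⇒↭ₛ (↭-sym perm)) (Unique.upTo⁺ n)) ,
    free321⁻ v free ,
    descents⁻ v S des

  perms-unique : Unique perms
  perms-unique =
    Unique.map⁻ (subst Unique (sym values∘fromValues) (gen-unique bits [] (upTo n) start))
    where
    values∘fromValues : map values perms ≡ words
    values∘fromValues = trans (sym (List.map-∘ words))
      (List.map-id-local (All.tabulate (λ xs∈ → word-values (gen-sound bits [] (upTo n) start xs∈))))

  perms-members : ∀ v → (v ∈ perms) ⇔ Counted v
  perms-members v = mk⇔ to from
    where
    to : v ∈ perms → Counted v
    to v∈ with xs , xs∈ , refl ← ∈-map⁻ (fromValues n) v∈ =
      word⇒counted _ (subst Word (sym (word-values w)) w)
      where
      w : Word xs
      w = gen-sound bits [] (upTo n) start xs∈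
    from : Counted v → v ∈ perms
    from c = subst (_∈ perms) (fromValues-values n v)
      (∈-map⁺ (fromValues n) (gen-complete bits [] (upTo n) start (counted⇒word v c)))

  perms-count : NoAdjacent (toList S) → length perms ≡ catalan (n ∸ ∣ S ∣)
  perms-count noAdj = begin
    length perms                    ≡⟨ List.length-map (fromValues n) words ⟩
    length words                    ≡⟨ length-gen bits [] (upTo n) ⟩
    count bits 0 (length (upTo n))  ≡⟨ cong (count bits 0) (List.length-applyUpTo id n) ⟩
    count bits 0 n                  ≡⟨ count-closed bits 0 n (length-toList S) noAdj ⟩
    dyck′ 0 n k                     ≡⟨ dyck′-≤ 0 k≤n ⟩
    dyck 0 (n ∸ k)                  ≡⟨ catalan≡dyck (n ∸ k) ⟨
    catalan (n ∸ k)                 ≡⟨ cong (λ k → catalan (n ∸ k)) (trues-card S) ⟩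
    catalan (n ∸ ∣ S ∣)             ∎
    where
    open ≡-Reasoning
    k : ℕ
    k = trues (toList S)
    k≤n : k ≤ n
    k≤n = ≤-trans (trues-bound (toList S) (length-toList S)) (m∸n≤m n 1)

theorem5p1 : (n : ℕ) (S : Subset (n ∸ 1)) →
    Σ (List (Vec (Fin n) n)) λ L →
    Unique L
    × ((v : Vec (Fin n) n) → (v ∈ L) ⇔ (IsPerm v × Avoids321 v × DesContains v S))
    × ((¬ HasConsecutive S → length L ≡ catalan (n ∸ ∣ S ∣))
    × (HasConsecutive S → length L ≡ 0))
theorem5p1 n S =
  perms , perms-unique , perms-members ,
  (λ ¬consecutive → perms-count (noAdjacent S ¬consecutive)) ,
  (λ consecutive → length-empty perms λ v v∈ →
     let (_ , avoids , des) = Equivalence.to (perms-members v) v∈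
     in consecutive⇒321 {v = v} consecutive des avoids)
  where open Enumeration n S
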